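{- Let $R$ be a generic rectangulation of size $n$, let $x$ be a 2-clumped permutation with $\gamma(x)=R$, let $T=\{t_1,\dots,t_p\}$ be a set that is good with respect to $x$, and let $T'=\{n+1-t_1,\dots,n+1-t_p\}$. Let $\mathrm{rf}_{\mathrm{anti}}(R)$ denote the generic rectangulation obtained by reflecting $R$ about the lower-left to upper-right diagonal of the square $S$. Then $x_{\max}(R,T)|_{T}=\mathrm{rv}\big(x_{\min}(\mathrm{rf}_{\mathrm{anti}}(R), T')|_{T'}\big)$.
   Context: A generic rectangulation is a tiling of a square $S$ by rectangles with no four sharing a vertex, up to combinatorial equivalence. There is a surjective map $\gamma$ from $S_n$ to generic rectangulations of size $n$; its fibers are intervals of the right weak order, and each fiber contains a unique 2-clumped permutation (its minimal element). For a permutation $x$ with $\gamma(x)=R$, a subset $T\subseteq[n]$ is good with respect to $x$ if there is a permutation $x'$ with $\gamma(x')=\gamma(x)$ (equivalently $\pi_\downarrow^2(x')=x$) whose first $|T|$ entries are exactly the elements of $T$. Then $x_{\min}(R,T)$ (resp. $x_{\max}(R,T)$) is the minimal (resp. maximal) element, in the right weak order on $S_n$, among permutations $x'$ with $\gamma(x')=R$ whose first $|T|$ entries form $T$; and $x_{\min}(R,T)|_T$, $x_{\max}(R,T)|_T$ denote the orderings of the elements of $T$ as they appear in those permutations. The map $\mathrm{rv}$ replaces each entry $a$ of a sequence with $n+1-a$. One has $\mathrm{rf}_{\mathrm{anti}}\circ\gamma=\gamma\circ\mathrm{rv}$. -}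

module Defs where

open import Data.Nat using (ℕ; suc)
open import Data.Fin using (Fin; toℕ; opposite; _<_)
open import Data.Fin.Subset using (Subset; _∈_; ∣_∣)
open import Data.Fin.Subset.Properties using (_∈?_)
open import Data.Vec using (Vec; lookup; map; toList; tabulate)
open import Data.List using (List; filter)
import Data.List as L
open import Data.Product using (Σ; ∃; _×_; _,_)
open import Data.Sum using (_⊎_)
open import Relation.Binary.PropositionalEquality using (_≡_; _≢_)
open import Relation.Binary.Construct.Closure.Equivalence using (EqClosure)
open import Relation.Nullary using (¬_)
open import Function.Bundles using (_⇔_)
import Data.Nat as N

-- A word of length n over [n] = Fin n; entry i is the value at position i.
-- Values are 0-based: Fin value a stands for the paper's value a+1.
Word : ℕ → Set
Word n = Vec (Fin n) n

IsPerm : ∀ {n} → Word n → Set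
IsPerm {n} v = ∀ (a : Fin n) → ∃ λ i → lookup v i ≡ a

-- rv : each entry a is replaced by n+1-a (0-based: opposite a = n-1-a).
rv : ∀ {n} → Word n → Word n
rv = map opposite

-- Inversions as pairs of values (a < b, b occurs before a); right weak order
-- is containment of inversion sets.
Inv : ∀ {n} → Word n → Fin n → Fin n → Set
Inv v a b = a < b × ∃ λ i → ∃ λ j → i < j × lookup v i ≡ b × lookup v j ≡ a

_≤w_ : ∀ {n} → Word n → Word n → Set
v ≤w w = ∀ a b → Inv v a b → Inv w a b

-- The 2-clump pattern condition on the adjacent positions i, j = i+1 of v:
-- their values are a < e (in some order), and there are values a<b<c<d<e with
-- c to the left and b,d to the right (patterns 3-51-24, 3-51-42 / 3-15-24, 3-15-42)
-- or c to the right and b,d to the left (patterns 24-51-3, 42-51-3 / 24-15-3, 42-15-3).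
ClumpAt : ∀ {n} → Word n → Fin n → Fin n → Set
ClumpAt {n} v i j =
  Σ (Fin n) λ a → Σ (Fin n) λ b → Σ (Fin n) λ c → Σ (Fin n) λ d → Σ (Fin n) λ e →
  ((lookup v i ≡ a × lookup v j ≡ e) ⊎ (lookup v i ≡ e × lookup v j ≡ a)) ×
  a < b × b < c × c < d × d < e ×
  Σ (Fin n) λ kb → Σ (Fin n) λ kc → Σ (Fin n) λ kd →
  lookup v kb ≡ b × lookup v kc ≡ c × lookup v kd ≡ d ×
  ((kc < i × j < kb × j < kd) ⊎ (j < kc × kb < i × kd < i))

Step : ∀ {n} → Word n → Word n → Set
Step {n} v w = Σ (Fin n) λ i → Σ (Fin n) λ j →
  toℕ j ≡ suc (toℕ i) × ClumpAt v i j ×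
  lookup w i ≡ lookup v j × lookup w j ≡ lookup v i ×
  (∀ k → k ≢ i → k ≢ j → lookup w k ≡ lookup v k)

-- γ(v) = γ(w): v and w lie in the same fiber of γ, i.e. the same class of
-- the 2-clumped congruence (equivalence closure of Step).
SameRect : ∀ {n} → Word n → Word n → Set
SameRect = EqClosure Step

-- 2-clumped permutations: permutations avoiding 3-51-24, 3-51-42, 24-51-3, 42-51-3,
-- i.e. no descent at adjacent positions satisfying the clump condition.
TwoClumped : ∀ {n} → Word n → Set
TwoClumped {n} v = IsPerm v ×
  ¬ (Σ (Fin n) λ i → Σ (Fin n) λ j →
       toℕ j ≡ suc (toℕ i) × lookup v j < lookup v i × ClumpAt v i j)

PrefixIs : ∀ {n} → Subset n → Word n → Set
PrefixIs T w = ∀ i → (toℕ i N.< ∣ T ∣) ⇔ (lookup w i ∈ T)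

rvSet : ∀ {n} → Subset n → Subset n
rvSet T = tabulate (λ a → lookup T (opposite a))

Good : ∀ {n} → Word n → Subset n → Set
Good x T = ∃ λ x' → IsPerm x' × SameRect x x' × PrefixIs T x'

FiberPrefix : ∀ {n} → Word n → Subset n → Word n → Set
FiberPrefix x T w = IsPerm w × SameRect x w × PrefixIs T w

IsMaxOf IsMinOf : ∀ {n} → (Word n → Set) → Word n → Set
IsMaxOf P m = P m × (∀ w → P w → w ≤w m)
IsMinOf P m = P m × (∀ w → P w → m ≤w w)

restrict : ∀ {n} → Subset n → Word n → List (Fin n)
restrict T v = filter (_∈? T) (toList v)

rvList : ∀ {n} → List (Fin n) → List (Fin n)
rvList = L.map opposite

{-# OPTIONS --safe #-}
-- The fiber of x is the class of x under the congruence generated by swapping adjacent clumped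
-- values. If two values sit at adjacent positions without forming a clump, their relative order
-- is the same in every word of the class: which values between them precede the smaller one is
-- preserved by clump swaps, since a clump containing the smaller one would need an alternation
-- that the non-clumped pair excludes. From this, each class is convex in the weak order, and a
-- word y of the class without clump ascents is its maximum, by downward induction on the words
-- below y. Now climb from a word of the fiber with prefix T along clump ascents that stay inside
-- the first |T| positions or inside the remaining ones; the result z orders each of the two
-- blocks as y does. Every word w of the fiber with prefix T lies below y and has the same prefix
-- set as z, so every inversion of w is one of z: z is the maximum. Reversing values maps classes
-- to classes, reverses the weak order and turns prefix T into prefix T', so rv z is the minimum
-- on the reflected side, and restriction commutes with rv.
module Submission where

open import Defs
open import Data.Nat using (ℕ)
open import Data.Fin.Subset using (Subset)
open import Data.Product using (Σ; _×_)
open import Relation.Binary.PropositionalEquality using (_≡_)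

open import Data.Bool using (true; false; if_then_else_)
import Data.Bool
open import Data.Empty using (⊥; ⊥-elim)
open import Data.Fin as F using (Fin; toℕ; opposite; _<_; _≟_; punchOut)
open import Data.Fin.Permutation.Components using (transpose)
import Data.Fin.Properties as FP
open import Data.Fin.Subset using (_∈_; ∣_∣; inside)
open import Data.Fin.Subset.Properties using (_∈?_)
open import Data.List as L using ([]; _∷_; length; filter; allFin; cartesianProduct)
open import Data.List.Membership.Propositional using () renaming (_∈_ to _∈ˡ_)
open import Data.List.Membership.Propositional.Properties using (∈-allFin; ∈-cartesianProduct⁺)
import Data.List.Properties as LP
open import Data.List.Relation.Unary.Any using (here; there)
open import Data.Nat as N using (zero; suc; _∸_; _+_)
open import Data.Nat.Induction using (<-wellFounded)
import Data.Nat.Properties as NP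
open import Data.Nat.Tactic.RingSolver using (solve-∀)
open import Data.Product using (∃; ∃₂; _,_; proj₁; proj₂)
open import Data.Sum using (_⊎_; inj₁; inj₂)
open import Data.Unit using (⊤; tt)
open import Data.Vec as V using (Vec; lookup; tabulate)
import Data.Vec.Properties as VP
open import Data.Vec.Relation.Binary.Pointwise.Extensional using (ext; Pointwise-≡⇒≡)
open import Function.Base using (_∘_; id)
open import Function.Bundles using (_⇔_; mk⇔; Equivalence)
open import Function.Definitions using (Injective)
import Function.Properties.Equivalence as ⇔
open import Induction.WellFounded using (WellFounded; Acc; acc)
open import Relation.Binary.Definitions using (Transitive; tri<; tri≈; tri>)
import Relation.Binary.Construct.Closure.Equivalence as EqClosure
import Relation.Binary.Construct.Closure.ReflexiveTransitive as Star
import Relation.Binary.Construct.Closure.Symmetric as SymClosure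
import Relation.Binary.Construct.On as On
open import Relation.Binary.PropositionalEquality
  using (_≢_; refl; sym; trans; cong; subst; subst₂; ≢-sym; module ≡-Reasoning)
open import Relation.Nullary using (¬_; Dec; yes; no; does)
open import Relation.Nullary.Decidable using (_×-dec_; _⊎-dec_; ¬?; dec-true; dec-false)
open import Relation.Unary using (Decidable)

private variable n : ℕ

Adjacent : Fin n → Fin n → Set
Adjacent i j = toℕ j ≡ suc (toℕ i)

Adjacent? : (i j : Fin n) → Dec (Adjacent i j)
Adjacent? i j = toℕ j N.≟ suc (toℕ i)

module _ {i j : Fin n} (adj : Adjacent i j) where

  Adjacent⇒< : i < j
  Adjacent⇒< rewrite adj = NP.≤-refl

  Adjacent-injectiveʳ : ∀ {j'} → Adjacent i j' → j ≡ j'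
  Adjacent-injectiveʳ adj' = FP.toℕ-injective (trans adj (sym adj'))

  Adjacent-injectiveˡ : ∀ {i'} → Adjacent i' j → i ≡ i'
  Adjacent-injectiveˡ adj' = FP.toℕ-injective (NP.suc-injective (trans (sym adj) adj'))

  Adjacent-after : ∀ {k} → i < k → k ≢ j → j < k
  Adjacent-after {k} i<k k≢j with NP.m≤n⇒m<n∨m≡n (subst (N._≤ toℕ k) (sym adj) i<k)
  ... | inj₁ j<k = j<k
  ... | inj₂ j≡k = ⊥-elim (k≢j (FP.toℕ-injective (sym j≡k)))

  Adjacent-before : ∀ {k} → k < j → k ≢ i → k < i
  Adjacent-before {k} k<j k≢i with NP.m≤n⇒m<n∨m≡n (N.s≤s⁻¹ (subst (toℕ k N.<_) adj k<j))
  ... | inj₁ k<i = k<i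
  ... | inj₂ k≡i = ⊥-elim (k≢i (FP.toℕ-injective k≡i))

adjacent-chain : ∀ {ℓ} {R : Fin n → Fin n → Set ℓ} → Transitive R → ∀ {p q} → p < q →
                 (∀ {i j} → Adjacent i j → p F.≤ i → j F.≤ q → R i j) → R p q
adjacent-chain {n = n} {R = R} R-trans {p} {q} p<q step =
  go (toℕ q ∸ suc (toℕ p)) q (sym (NP.m∸n+n≡m p<q)) NP.≤-refl
  where
  go : ∀ d r → toℕ r ≡ d + suc (toℕ p) → r F.≤ q → R p r
  go zero r r≡1+p r≤q = step r≡1+p NP.≤-refl r≤q
  go (suc d) r r≡d+2+p r≤q = R-trans (go d r' r'≡ (NP.<⇒≤ r'<q)) (step r'adj r'≥p r≤q)
    where
    r'<n : d + suc (toℕ p) N.< n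
    r'<n = NP.<-trans (NP.n<1+n _) (subst (N._< n) r≡d+2+p (FP.toℕ<n r))
    r' : Fin n
    r' = F.fromℕ< r'<n
    r'≡ : toℕ r' ≡ d + suc (toℕ p)
    r'≡ = FP.toℕ-fromℕ< r'<n
    r'adj : Adjacent r' r
    r'adj = trans r≡d+2+p (cong suc (sym r'≡))
    r'<q : r' < q
    r'<q = NP.<-≤-trans (Adjacent⇒< r'adj) r≤q
    r'≥p : p F.≤ r'
    r'≥p = subst (toℕ p N.≤_) (sym r'≡) (NP.≤-trans (NP.n≤1+n _) (NP.m≤n+m _ d))

adjacent-increasing⇒id : (f : Fin n → Fin n) → (∀ {i j} → Adjacent i j → f i < f j) → ∀ k → f k ≡ k
adjacent-increasing⇒id {suc m} f f-adjacent k = FP.toℕ-injective (NP.≤-antisym upper lower)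
  where
  -- f q − f p ≥ q − p, stated without truncated subtraction
  Spread : Fin (suc m) → Fin (suc m) → Set
  Spread p q = toℕ q + toℕ (f p) N.≤ toℕ p + toℕ (f q)
  spread-adjacent : ∀ {p q} → Adjacent p q → Spread p q
  spread-adjacent {p} {q} adj rewrite adj =
    subst (N._≤ toℕ p + toℕ (f q)) (NP.+-suc (toℕ p) (toℕ (f p))) (NP.+-monoʳ-≤ (toℕ p) (f-adjacent adj))
  spread-trans : Transitive Spread
  spread-trans {p} {q} {r} pq qr = NP.+-cancelˡ-≤ (toℕ q + toℕ (f q)) _ _ (begin
    toℕ q + toℕ (f q) + (toℕ r + toℕ (f p)) ≡⟨ rearrange (toℕ q) (toℕ (f q)) (toℕ r) (toℕ (f p)) ⟩
    (toℕ q + toℕ (f p)) + (toℕ r + toℕ (f q)) ≤⟨ NP.+-mono-≤ pq qr ⟩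
    (toℕ p + toℕ (f q)) + (toℕ q + toℕ (f r)) ≡⟨ rearrange′ (toℕ p) (toℕ (f q)) (toℕ q) (toℕ (f r)) ⟩
    toℕ q + toℕ (f q) + (toℕ p + toℕ (f r)) ∎)
    where
    open NP.≤-Reasoning
    rearrange : ∀ x y z w → x + y + (z + w) ≡ (x + w) + (z + y)
    rearrange = solve-∀
    rearrange′ : ∀ x y z w → (x + y) + (z + w) ≡ z + y + (x + w)
    rearrange′ = solve-∀
  spread : ∀ {p q} → p F.≤ q → Spread p q
  spread {p} {q} p≤q with p ≟ q
  ... | yes refl = NP.≤-refl
  ... | no p≢q = adjacent-chain spread-trans (FP.≤∧≢⇒< p≤q p≢q) λ adj _ _ → spread-adjacent adj
  lower : toℕ k N.≤ toℕ (f k)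
  lower = NP.≤-trans (NP.m≤m+n (toℕ k) _) (spread {p = F.zero} N.z≤n)
  upper : toℕ (f k) N.≤ toℕ k
  upper = NP.+-cancelʳ-≤ m _ _ (begin
    toℕ (f k) + m ≡⟨ NP.+-comm (toℕ (f k)) m ⟩
    m + toℕ (f k) ≡⟨ cong (_+ toℕ (f k)) (sym (FP.toℕ-fromℕ m)) ⟩
    toℕ (F.fromℕ m) + toℕ (f k) ≤⟨ spread k≤last ⟩
    toℕ k + toℕ (f (F.fromℕ m)) ≤⟨ NP.+-monoʳ-≤ (toℕ k) (FP.toℕ≤pred[n] (f (F.fromℕ m))) ⟩
    toℕ k + m ∎)
    where
    open NP.≤-Reasoning
    k≤last : k F.≤ F.fromℕ m
    k≤last = subst (toℕ k N.≤_) (sym (FP.toℕ-fromℕ m)) (FP.toℕ≤pred[n] k)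

surjective⇒injective : (f : Fin n → Fin n) → (∀ a → ∃ λ i → f i ≡ a) → Injective _≡_ _≡_ f
surjective⇒injective {zero} f surj {()}
surjective⇒injective {suc m} f surj {i} {j} fi≡fj with i ≟ j
... | yes i≡j = i≡j
... | no i≢j = ⊥-elim (NP.1+n≰n (FP.injective⇒≤ punched-injective))
  where
  s : Fin (suc m) → Fin (suc m)
  s a = proj₁ (surj a)
  f∘s : ∀ a → f (s a) ≡ a
  f∘s a = proj₂ (surj a)
  s-injective : Injective _≡_ _≡_ s
  s-injective {a} {b} sa≡sb = trans (sym (f∘s a)) (trans (cong f sa≡sb) (f∘s b))
  section-at : ∀ {a k} → s a ≡ k → f k ≡ f i → s (f i) ≡ k
  section-at {a} sa≡k fk≡fi =
    trans (cong s (trans (sym fk≡fi) (trans (cong f (sym sa≡k)) (f∘s a)))) sa≡k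
  missed : Dec (s (f i) ≡ i) → ∃ λ k → ∀ a → k ≢ s a
  missed (yes s[fi]≡i) =
    j , λ a j≡sa → i≢j (trans (sym s[fi]≡i) (section-at (sym j≡sa) (sym fi≡fj)))
  missed (no s[fi]≢i) = i , λ a i≡sa → s[fi]≢i (section-at (sym i≡sa) refl)
  k : Fin (suc m)
  k = proj₁ (missed (s (f i) ≟ i))
  k-missed : ∀ a → k ≢ s a
  k-missed = proj₂ (missed (s (f i) ≟ i))
  punched : Fin (suc m) → Fin m
  punched a = punchOut (k-missed a)
  punched-injective : Injective _≡_ _≡_ punched
  punched-injective {a} {b} eq = s-injective (FP.punchOut-injective (k-missed a) (k-missed b) eq)

IsPerm⇒injective : {v : Word n} → IsPerm v → Injective _≡_ _≡_ (lookup v)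
IsPerm⇒injective {v = v} perm = surjective⇒injective (lookup v) perm

Precedes : Word n → Fin n → Fin n → Set
Precedes v p q = ∃ λ i → ∃ λ j → i < j × lookup v i ≡ p × lookup v j ≡ q

module _ {v : Word n} (perm : IsPerm v) where

  private
    inj : Injective _≡_ _≡_ (lookup v)
    inj = IsPerm⇒injective {v = v} perm

  Precedes-asym : ∀ {p q} → Precedes v p q → ¬ Precedes v q p
  Precedes-asym (i , j , i<j , vi , vj) (k , l , k<l , vk , vl)
    with inj (trans vi (sym vl)) | inj (trans vj (sym vk))
  ... | refl | refl = NP.<-asym i<j k<l

  Precedes-trans : ∀ {p q r} → Precedes v p q → Precedes v q r → Precedes v p r
  Precedes-trans (i , j , i<j , vi , vj) (k , l , k<l , vk , vl) with inj (trans vj (sym vk))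
  ... | refl = i , l , NP.<-trans i<j k<l , vi , vl

  Precedes-total : ∀ {p q} → p ≢ q → Precedes v p q ⊎ Precedes v q p
  Precedes-total {p} {q} p≢q with perm p | perm q
  ... | i , vi | j , vj with FP.<-cmp i j
  ... | tri< i<j _ _ = inj₁ (i , j , i<j , vi , vj)
  ... | tri≈ _ refl _ = ⊥-elim (p≢q (trans (sym vi) vj))
  ... | tri> _ _ j<i = inj₂ (j , i , j<i , vj , vi)

  ¬Precedes⇒Precedes : ∀ {p q} → p ≢ q → ¬ Precedes v p q → Precedes v q p
  ¬Precedes⇒Precedes p≢q ¬pq with Precedes-total p≢q
  ... | inj₁ pq = ⊥-elim (¬pq pq)
  ... | inj₂ qp = qp

Precedes? : (v : Word n) → ∀ p q → Dec (Precedes v p q)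
Precedes? v p q =
  FP.any? λ i → FP.any? λ j → (i FP.<? j) ×-dec (lookup v i ≟ p) ×-dec (lookup v j ≟ q)

precedes-at : {v : Word n} {i j : Fin n} → i < j → Precedes v (lookup v i) (lookup v j)
precedes-at i<j = _ , _ , i<j , refl , refl

record Swapped (v w : Word n) (i j : Fin n) : Set where
  field
    adjacent : Adjacent i j
    at-i : lookup w i ≡ lookup v j
    at-j : lookup w j ≡ lookup v i
    elsewhere : ∀ k → k ≢ i → k ≢ j → lookup w k ≡ lookup v k

swap : Word n → Fin n → Fin n → Word n
swap v i j = tabulate (lookup v ∘ transpose i j)

swap-Swapped : (v : Word n) {i j : Fin n} → Adjacent i j → Swapped v (swap v i j) i j
swap-Swapped v {i} {j} adj = record
  { adjacent = adj
  ; at-i = trans (lookup-swap i) (cong (lookup v) transpose-i)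
  ; at-j = trans (lookup-swap j) (cong (lookup v) transpose-j)
  ; elsewhere = λ k k≢i k≢j → trans (lookup-swap k) (cong (lookup v) (transpose-k k≢i k≢j))
  }
  where
  lookup-swap : ∀ k → lookup (swap v i j) k ≡ lookup v (transpose i j k)
  lookup-swap = VP.lookup∘tabulate (lookup v ∘ transpose i j)
  transpose-i : transpose i j i ≡ j
  transpose-i rewrite dec-true (i ≟ i) refl = refl
  transpose-j : transpose i j j ≡ i
  transpose-j rewrite dec-false (j ≟ i) (≢-sym (FP.<⇒≢ (Adjacent⇒< adj))) | dec-true (j ≟ j) refl =
    refl
  transpose-k : ∀ {k} → k ≢ i → k ≢ j → transpose i j k ≡ k
  transpose-k {k} k≢i k≢j rewrite dec-false (k ≟ i) k≢i | dec-false (k ≟ j) k≢j = refl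

module _ {v w : Word n} {i j : Fin n} (sw : Swapped v w i j) where
  open Swapped sw

  Swapped-sym : Swapped w v i j
  Swapped-sym = record
    { adjacent = adjacent
    ; at-i = sym at-j
    ; at-j = sym at-i
    ; elsewhere = λ k k≢i k≢j → sym (elsewhere k k≢i k≢j)
    }

  Swapped-isPerm : IsPerm v → IsPerm w
  Swapped-isPerm perm a with perm a
  ... | k , vk≡a with k ≟ i | k ≟ j
  ... | yes refl | _ = j , trans at-j vk≡a
  ... | no _ | yes refl = i , trans at-i vk≡a
  ... | no k≢i | no k≢j = k , trans (elsewhere k k≢i k≢j) vk≡a

  Swapped-left : ∀ {k} → k < i → lookup w k ≡ lookup v k
  Swapped-left k<i = elsewhere _ (FP.<⇒≢ k<i) (FP.<⇒≢ (NP.<-trans k<i (Adjacent⇒< adjacent)))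

  Swapped-right : ∀ {k} → j < k → lookup w k ≡ lookup v k
  Swapped-right j<k =
    elsewhere _ (≢-sym (FP.<⇒≢ (NP.<-trans (Adjacent⇒< adjacent) j<k))) (≢-sym (FP.<⇒≢ j<k))

  Precedes-Swapped : ∀ {p q} → Precedes v p q → ¬ (p ≡ lookup v i × q ≡ lookup v j) → Precedes w p q
  Precedes-Swapped (k , l , k<l , vk , vl) not-ij with k ≟ i | k ≟ j
  ... | yes refl | _ with l ≟ j
  ...   | yes refl = ⊥-elim (not-ij (sym vk , sym vl))
  ...   | no l≢j = j , l , Adjacent-after adjacent k<l l≢j , trans at-j vk ,
                   trans (elsewhere l (≢-sym (FP.<⇒≢ k<l)) l≢j) vl
  Precedes-Swapped (k , l , k<l , vk , vl) not-ij | no k≢i | yes refl =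
    i , l , NP.<-trans (Adjacent⇒< adjacent) k<l , trans at-i vk , trans (Swapped-right k<l) vl
  Precedes-Swapped (k , l , k<l , vk , vl) not-ij | no k≢i | no k≢j with l ≟ i | l ≟ j
  ... | yes refl | _ =
    k , j , NP.<-trans k<l (Adjacent⇒< adjacent) , trans (elsewhere k k≢i k≢j) vk , trans at-j vl
  ... | no _ | yes refl =
    k , i , Adjacent-before adjacent k<l k≢i , trans (elsewhere k k≢i k≢j) vk , trans at-i vl
  ... | no l≢i | no l≢j =
    k , l , k<l , trans (elsewhere k k≢i k≢j) vk , trans (elsewhere l l≢i l≢j) vl

-- The right weak order

≤w-refl : {v : Word n} → v ≤w v
≤w-refl a b inv = inv

≤w-trans : {u v w : Word n} → u ≤w v → v ≤w w → u ≤w w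
≤w-trans u≤v v≤w a b inv = v≤w a b (u≤v a b inv)

¬Inv-adjacent : {v : Word n} {i j : Fin n} → IsPerm v → Adjacent i j → ¬ Inv v (lookup v i) (lookup v j)
¬Inv-adjacent {v = v} perm adj (_ , ji) =
  Precedes-asym {v = v} perm ji (precedes-at {v = v} (Adjacent⇒< adj))

module _ {v w : Word n} {i j : Fin n} (sw : Swapped v w i j) where
  open Swapped sw

  Inv-Swapped-new : lookup v i < lookup v j → Inv w (lookup v i) (lookup v j)
  Inv-Swapped-new asc = asc , _ , _ , Adjacent⇒< adjacent , at-i , at-j

  ≤w-Swapped : lookup v i < lookup v j → v ≤w w
  ≤w-Swapped asc a b (a<b , ba) =
    a<b , Precedes-Swapped sw ba λ { (b≡ , a≡) → NP.<-asym asc (subst₂ _<_ a≡ b≡ a<b) }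

  Inv-Swapped⁻ : ∀ {a b} → Inv w a b → Inv v a b ⊎ (a ≡ lookup v i × b ≡ lookup v j)
  Inv-Swapped⁻ {a} {b} (a<b , ba) with (b ≟ lookup w i) ×-dec (a ≟ lookup w j)
  ... | yes (b≡wi , a≡wj) = inj₂ (trans a≡wj at-j , trans b≡wi at-i)
  ... | no ¬ij = inj₁ (a<b , Precedes-Swapped (Swapped-sym sw) ba ¬ij)

  ≤w-Swapped-below : {y : Word n} → v ≤w y → Inv y (lookup v i) (lookup v j) → w ≤w y
  ≤w-Swapped-below v≤y inv-y a b inv with Inv-Swapped⁻ inv
  ... | inj₁ inv-v = v≤y a b inv-v
  ... | inj₂ (refl , refl) = inv-y

module _ {A : Set} {P Q : A → Set} (P? : Decidable P) (Q? : Decidable Q) (P⇒Q : ∀ {x} → P x → Q x)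
         where

  length-filter-mono : ∀ xs → length (filter P? xs) N.≤ length (filter Q? xs)
  length-filter-mono [] = N.z≤n
  length-filter-mono (x ∷ xs) with P? x | Q? x
  ... | yes _ | yes _ = N.s≤s (length-filter-mono xs)
  ... | yes p | no ¬q = ⊥-elim (¬q (P⇒Q p))
  ... | no _ | yes _ = NP.m≤n⇒m≤1+n (length-filter-mono xs)
  ... | no _ | no _ = length-filter-mono xs

  length-filter-mono-< : ∀ {y} xs → y ∈ˡ xs → Q y → ¬ P y →
                         length (filter P? xs) N.< length (filter Q? xs)
  length-filter-mono-< (x ∷ xs) (here refl) qx ¬px with P? x | Q? x
  ... | yes px | _ = ⊥-elim (¬px px)
  ... | no _ | yes _ = N.s≤s (length-filter-mono xs)
  ... | no _ | no ¬qx = ⊥-elim (¬qx qx)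
  length-filter-mono-< (x ∷ xs) (there y∈xs) qy ¬py with P? x | Q? x
  ... | yes _ | yes _ = N.s≤s (length-filter-mono-< xs y∈xs qy ¬py)
  ... | yes p | no ¬q = ⊥-elim (¬q (P⇒Q p))
  ... | no _ | yes _ = NP.m≤n⇒m≤1+n (length-filter-mono-< xs y∈xs qy ¬py)
  ... | no _ | no _ = length-filter-mono-< xs y∈xs qy ¬py

NonInv : Word n → Fin n × Fin n → Set
NonInv v (a , b) = ¬ Inv v a b

NonInv? : (v : Word n) → Decidable (NonInv v)
NonInv? v (a , b) = ¬? ((a FP.<? b) ×-dec Precedes? v b a)

nonInversions : Word n → ℕ
nonInversions {n} v = length (filter (NonInv? v) (cartesianProduct (allFin n) (allFin n)))

Higher : Word n → Word n → Set
Higher w v = nonInversions w N.< nonInversions v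

Higher-wellFounded : WellFounded (Higher {n})
Higher-wellFounded = On.wellFounded nonInversions <-wellFounded

Swapped-Higher : {v w : Word n} {i j : Fin n} → IsPerm v → Swapped v w i j → lookup v i < lookup v j →
                 Higher w v
Swapped-Higher {v = v} {w} perm sw asc =
  length-filter-mono-< (NonInv? w) (NonInv? v) (λ ¬inv-w inv-v → ¬inv-w (≤w-Swapped sw asc _ _ inv-v)) _
    (∈-cartesianProduct⁺ (∈-allFin _) (∈-allFin _))
    (¬Inv-adjacent {v = v} perm (Swapped.adjacent sw)) (λ ¬inv → ¬inv (Inv-Swapped-new sw asc))

LeftOf RightOf : Word n → Fin n → Fin n → Set
LeftOf v i u = ∃ λ k → k < i × lookup v k ≡ u
RightOf v j u = ∃ λ k → j < k × lookup v k ≡ u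

PairAt : Word n → Fin n → Fin n → Fin n → Fin n → Set
PairAt v i j lo hi = (lookup v i ≡ lo × lookup v j ≡ hi) ⊎ (lookup v i ≡ hi × lookup v j ≡ lo)

Sides : Word n → Fin n → Fin n → Fin n → Fin n → Fin n → Set
Sides v i j b c d = (LeftOf v i c × RightOf v j b × RightOf v j d) ⊎
                    (RightOf v j c × LeftOf v i b × LeftOf v i d)

record ClumpView (v : Word n) (i j : Fin n) : Set where
  constructor clump
  field
    lo b c d hi : Fin n
    pair : PairAt v i j lo hi
    lo<b : lo < b
    b<c : b < c
    c<d : c < d
    d<hi : d < hi
    sides : Sides v i j b c d

  lo<hi : lo < hi
  lo<hi = NP.<-trans lo<b (NP.<-trans b<c (NP.<-trans c<d d<hi))

toClumpAt : {v : Word n} {i j : Fin n} → ClumpView v i j → ClumpAt v i j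
toClumpAt (clump lo b c d hi pair o1 o2 o3 o4
             (inj₁ ((kc , kc<i , vc) , (kb , j<kb , vb) , (kd , j<kd , vd)))) =
  lo , b , c , d , hi , pair , o1 , o2 , o3 , o4 , kb , kc , kd , vb , vc , vd , inj₁ (kc<i , j<kb , j<kd)
toClumpAt (clump lo b c d hi pair o1 o2 o3 o4
             (inj₂ ((kc , j<kc , vc) , (kb , kb<i , vb) , (kd , kd<i , vd)))) =
  lo , b , c , d , hi , pair , o1 , o2 , o3 , o4 , kb , kc , kd , vb , vc , vd , inj₂ (j<kc , kb<i , kd<i)

fromClumpAt : {v : Word n} {i j : Fin n} → ClumpAt v i j → ClumpView v i j
fromClumpAt (lo , b , c , d , hi , pair , o1 , o2 , o3 , o4 , kb , kc , kd , vb , vc , vd ,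
             inj₁ (kc<i , j<kb , j<kd)) =
  clump lo b c d hi pair o1 o2 o3 o4 (inj₁ ((kc , kc<i , vc) , (kb , j<kb , vb) , (kd , j<kd , vd)))
fromClumpAt (lo , b , c , d , hi , pair , o1 , o2 , o3 , o4 , kb , kc , kd , vb , vc , vd ,
             inj₂ (j<kc , kb<i , kd<i)) =
  clump lo b c d hi pair o1 o2 o3 o4 (inj₂ ((kc , j<kc , vc) , (kb , kb<i , vb) , (kd , kd<i , vd)))

ClumpAt? : (v : Word n) (i j : Fin n) → Dec (ClumpAt v i j)
ClumpAt? v i j =
  FP.any? λ a → FP.any? λ b → FP.any? λ c → FP.any? λ d → FP.any? λ e →
   (((lookup v i ≟ a) ×-dec (lookup v j ≟ e)) ⊎-dec ((lookup v i ≟ e) ×-dec (lookup v j ≟ a))) ×-dec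
   (a FP.<? b) ×-dec (b FP.<? c) ×-dec (c FP.<? d) ×-dec (d FP.<? e) ×-dec
   (FP.any? λ kb → FP.any? λ kc → FP.any? λ kd →
     (lookup v kb ≟ b) ×-dec (lookup v kc ≟ c) ×-dec (lookup v kd ≟ d) ×-dec
     (((kc FP.<? i) ×-dec (j FP.<? kb) ×-dec (j FP.<? kd)) ⊎-dec
      ((j FP.<? kc) ×-dec (kb FP.<? i) ×-dec (kd FP.<? i))))

-- Only the values strictly between the two clumped values matter for being a clump.
ClumpView-transport : {v w : Word n} {i j i' j' : Fin n} (C : ClumpView v i j) → let open ClumpView C in
  PairAt w i' j' lo hi →
  (∀ {u} → lo < u → u < hi → LeftOf v i u → LeftOf w i' u) →
  (∀ {u} → lo < u → u < hi → RightOf v j u → RightOf w j' u) → ClumpAt w i' j'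
ClumpView-transport {v = v} {w} {i} {j} {i'} {j'} (clump lo b c d hi _ o1 o2 o3 o4 sides) pair' L R =
  toClumpAt {v = w} (clump lo b c d hi pair' o1 o2 o3 o4 (transport sides))
  where
  lo<c = NP.<-trans o1 o2
  lo<d = NP.<-trans lo<c o3
  b<hi = NP.<-trans o2 (NP.<-trans o3 o4)
  c<hi = NP.<-trans o3 o4
  transport : Sides v i j b c d → Sides w i' j' b c d
  transport (inj₁ (lc , rb , rd)) = inj₁ (L lo<c c<hi lc , R o1 b<hi rb , R lo<d o4 rd)
  transport (inj₂ (rc , lb , ld)) = inj₂ (R lo<c c<hi rc , L o1 b<hi lb , L lo<d o4 ld)

ClumpView-ascent : {v : Word n} {i j : Fin n} (C : ClumpView v i j) → lookup v i < lookup v j →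
                   ClumpView.lo C ≡ lookup v i × ClumpView.hi C ≡ lookup v j
ClumpView-ascent C asc with ClumpView.pair C
... | inj₁ (vi≡lo , vj≡hi) = sym vi≡lo , sym vj≡hi
... | inj₂ (vi≡hi , vj≡lo) = ⊥-elim (NP.<-asym (ClumpView.lo<hi C) (subst₂ _<_ vi≡hi vj≡lo asc))

ClumpAt-transport-ascent : {v w : Word n} {i j i' j' : Fin n} → ClumpAt v i j → lookup v i < lookup v j →
  lookup w i' ≡ lookup v i → lookup w j' ≡ lookup v j →
  (∀ {u} → lookup v i < u → u < lookup v j → LeftOf v i u → LeftOf w i' u) →
  (∀ {u} → lookup v i < u → u < lookup v j → RightOf v j u → RightOf w j' u) → ClumpAt w i' j'
ClumpAt-transport-ascent {v = v} {w} C asc wi' wj' L R with fromClumpAt {v = v} C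
... | V with ClumpView-ascent V asc
... | refl , refl = ClumpView-transport {v = v} {w} V (inj₁ (wi' , wj')) L R

ClumpAt-ascent-left : {v : Word n} {i j : Fin n} → ClumpAt v i j → lookup v i < lookup v j →
                      ∃ λ u → lookup v i < u × u < lookup v j × LeftOf v i u
ClumpAt-ascent-left {v = v} C asc with fromClumpAt {v = v} C
... | V@(clump _ b c _ _ _ o1 o2 o3 o4 sides) with ClumpView-ascent V asc | sides
... | refl , refl | inj₁ (lc , _ , _) = c , NP.<-trans o1 o2 , NP.<-trans o3 o4 , lc
... | refl , refl | inj₂ (_ , lb , _) = b , o1 , NP.<-trans o2 (NP.<-trans o3 o4) , lb

ClumpAt-ascent-right : {v : Word n} {i j : Fin n} → ClumpAt v i j → lookup v i < lookup v j →
                       ∃ λ u → lookup v i < u × u < lookup v j × RightOf v j u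
ClumpAt-ascent-right {v = v} C asc with fromClumpAt {v = v} C
... | V@(clump _ b c _ _ _ o1 o2 o3 o4 sides) with ClumpView-ascent V asc | sides
... | refl , refl | inj₁ (_ , rb , _) = b , o1 , NP.<-trans o2 (NP.<-trans o3 o4) , rb
... | refl , refl | inj₂ (rc , _ , _) = c , NP.<-trans o1 o2 , NP.<-trans o3 o4 , rc

module _ {v w : Word n} {k k' : Fin n} (sw : Swapped v w k k') where
  open Swapped sw

  LeftOf-Swapped : ∀ {i u} → k ≢ i → k' ≢ i → LeftOf v i u → LeftOf w i u
  LeftOf-Swapped {i} k≢i k'≢i (p , p<i , vp) with p ≟ k | p ≟ k'
  ... | yes refl | _ = k' , Adjacent-after adjacent p<i (≢-sym k'≢i) , trans at-j vp
  ... | no _ | yes refl = k , NP.<-trans (Adjacent⇒< adjacent) p<i , trans at-i vp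
  ... | no p≢k | no p≢k' = p , p<i , trans (elsewhere p p≢k p≢k') vp

  RightOf-Swapped : ∀ {j u} → k ≢ j → k' ≢ j → RightOf v j u → RightOf w j u
  RightOf-Swapped {j} k≢j k'≢j (p , j<p , vp) with p ≟ k | p ≟ k'
  ... | yes refl | _ = k' , NP.<-trans j<p (Adjacent⇒< adjacent) , trans at-j vp
  ... | no _ | yes refl = k , Adjacent-before adjacent j<p (≢-sym k≢j) , trans at-i vp
  ... | no p≢k | no p≢k' = p , j<p , trans (elsewhere p p≢k p≢k') vp

  ClumpAt-Swapped : ClumpAt v k k' → ClumpAt w k k'
  ClumpAt-Swapped C =
    ClumpView-transport {v = v} {w} V (swap-pair (ClumpView.pair V)) (λ _ _ → left) (λ _ _ → right)
    where
    V : ClumpView v k k'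
    V = fromClumpAt {v = v} C
    swap-pair : ∀ {lo hi} → PairAt v k k' lo hi → PairAt w k k' lo hi
    swap-pair (inj₁ (vk , vk')) = inj₂ (trans at-i vk' , trans at-j vk)
    swap-pair (inj₂ (vk , vk')) = inj₁ (trans at-i vk' , trans at-j vk)
    left : ∀ {u} → LeftOf v k u → LeftOf w k u
    left (p , p<k , vp) = p , p<k , trans (Swapped-left sw p<k) vp
    right : ∀ {u} → RightOf v k' u → RightOf w k' u
    right (p , k'<p , vp) = p , k'<p , trans (Swapped-right sw k'<p) vp

-- The 2-clumped congruence

Step⇒Swapped : {v w : Word n} → Step v w → ∃ λ i → ∃ λ j → ClumpAt v i j × Swapped v w i j
Step⇒Swapped (i , j , adj , C , wi , wj , wk) =
  i , j , C , record { adjacent = adj ; at-i = wi ; at-j = wj ; elsewhere = wk }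

Swapped⇒Step : {v w : Word n} {i j : Fin n} → ClumpAt v i j → Swapped v w i j → Step v w
Swapped⇒Step {i = i} {j} C sw = i , j , adjacent , C , at-i , at-j , elsewhere
  where open Swapped sw

Step-sym : {v w : Word n} → Step v w → Step w v
Step-sym {v = v} {w} st with Step⇒Swapped {v = v} {w} st
... | _ , _ , C , sw = Swapped⇒Step {v = w} {v} (ClumpAt-Swapped sw C) (Swapped-sym sw)

Step-isPerm : {v w : Word n} → Step v w → IsPerm v → IsPerm w
Step-isPerm {v = v} {w} st with Step⇒Swapped {v = v} {w} st
... | _ , _ , _ , sw = Swapped-isPerm sw

SameRect-sym : {v w : Word n} → SameRect v w → SameRect w v
SameRect-sym = EqClosure.symmetric Step

SameRect-trans : {u v w : Word n} → SameRect u v → SameRect v w → SameRect u w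
SameRect-trans = EqClosure.transitive Step

SameRect-step : {v w : Word n} → Step v w → SameRect v w
SameRect-step = EqClosure.return

SameRect-invariant : ∀ {ℓ} (P : Word n → Set ℓ) → (∀ {v w} → Step v w → P v → P w) →
                     ∀ {v w} → SameRect v w → P v → P w
SameRect-invariant P step-preserves =
  Star.fold (λ v w → P v → P w) (λ st rest → rest ∘ step-preserves st) id
  ∘ Star.map (SymClosure.fold (λ {v} {w} → Step-sym {v = v} {w}) id)

-- Non-clumped adjacent pairs

module _ {v : Word n} {i j : Fin n} where

  PairAt-lo : ∀ {lo hi} → PairAt v i j lo hi → lookup v i ≡ lo ⊎ lookup v j ≡ lo
  PairAt-lo (inj₁ (vi , _)) = inj₁ vi
  PairAt-lo (inj₂ (_ , vj)) = inj₂ vj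

  PairAt-between : ∀ {lo hi u} → PairAt v i j lo hi → lo < u → u < hi → u ≢ lookup v i × u ≢ lookup v j
  PairAt-between (inj₁ (vi , vj)) lo<u u<hi =
    (λ u≡vi → FP.<⇒≢ lo<u (sym (trans u≡vi vi))) , (λ u≡vj → FP.<⇒≢ u<hi (trans u≡vj vj))
  PairAt-between (inj₂ (vi , vj)) lo<u u<hi =
    (λ u≡vi → FP.<⇒≢ u<hi (trans u≡vi vi)) , (λ u≡vj → FP.<⇒≢ lo<u (sym (trans u≡vj vj)))

module _ {v : Word n} {i j : Fin n} (adj : Adjacent i j) where

  LeftOf⇒Precedes : ∀ {x u} → lookup v i ≡ x ⊎ lookup v j ≡ x → LeftOf v i u → Precedes v u x
  LeftOf⇒Precedes (inj₁ vi) (k , k<i , vk) = k , i , k<i , vk , vi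
  LeftOf⇒Precedes (inj₂ vj) (k , k<i , vk) = k , j , NP.<-trans k<i (Adjacent⇒< adj) , vk , vj

  RightOf⇒Precedes : ∀ {x u} → lookup v i ≡ x ⊎ lookup v j ≡ x → RightOf v j u → Precedes v x u
  RightOf⇒Precedes (inj₁ vi) (k , j<k , vk) = i , k , NP.<-trans (Adjacent⇒< adj) j<k , vi , vk
  RightOf⇒Precedes (inj₂ vj) (k , j<k , vk) = j , k , j<k , vj , vk

module _ {v : Word n} {i j : Fin n} (perm : IsPerm v) (adj : Adjacent i j) where

  private
    inj : Injective _≡_ _≡_ (lookup v)
    inj = IsPerm⇒injective {v = v} perm

  Precedes⇒LeftOf : ∀ {x u} → lookup v i ≡ x ⊎ lookup v j ≡ x →
                    u ≢ lookup v i → Precedes v u x → LeftOf v i u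
  Precedes⇒LeftOf {x} x-at u≢vi (k , l , k<l , vk , vl) = k , k<i x-at , vk
    where
    k<i : lookup v i ≡ x ⊎ lookup v j ≡ x → k < i
    k<i (inj₁ vi) with inj (trans vl (sym vi))
    ... | refl = k<l
    k<i (inj₂ vj) with inj (trans vl (sym vj))
    ... | refl = Adjacent-before adj k<l λ { refl → u≢vi (sym vk) }

  Precedes⇒RightOf : ∀ {x u} → lookup v i ≡ x ⊎ lookup v j ≡ x →
                     u ≢ lookup v j → Precedes v x u → RightOf v j u
  Precedes⇒RightOf {x} x-at u≢vj (l , k , l<k , vl , vk) = k , j<k x-at , vk
    where
    j<k : lookup v i ≡ x ⊎ lookup v j ≡ x → j < k
    j<k (inj₁ vi) with inj (trans vl (sym vi))
    ... | refl = Adjacent-after adj l<k λ { refl → u≢vj (sym vk) }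
    j<k (inj₂ vj) with inj (trans vl (sym vj))
    ... | refl = l<k

PairAt-unique : {v : Word n} {i j lo hi a e : Fin n} → PairAt v i j lo hi → lo < hi → PairAt v i j a e → a < e →
                lo ≡ a × hi ≡ e
PairAt-unique (inj₁ (vi , vj)) _ (inj₁ (vi' , vj')) _ = trans (sym vi) vi' , trans (sym vj) vj'
PairAt-unique (inj₂ (vi , vj)) _ (inj₂ (vi' , vj')) _ = trans (sym vj) vj' , trans (sym vi) vi'
PairAt-unique (inj₁ (vi , vj)) lo<hi (inj₂ (vi' , vj')) a<e =
  ⊥-elim (NP.<-asym lo<hi (subst₂ _<_ (trans (sym vj') vj) (trans (sym vi') vi) a<e))
PairAt-unique (inj₂ (vi , vj)) lo<hi (inj₁ (vi' , vj')) a<e =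
  ⊥-elim (NP.<-asym lo<hi (subst₂ _<_ (trans (sym vi') vi) (trans (sym vj') vj) a<e))

-- If S has no alternating triple in (a, e), no clump swap exchanges a with a value of (a, e], so
-- the separation of (a, e] into the values of S before a and the others after a is preserved.
module SeparatedBy (a e : Fin n) (S : Fin n → Set) (S? : Decidable S) where

  Separates : Word n → Set
  Separates v = ∀ {q} → a < q → q F.≤ e → (S q → Precedes v q a) × (¬ S q → Precedes v a q)

  Alternation-free : Set
  Alternation-free = ∀ {b c d} → a < b → b < c → c < d → d < e →
                     ¬ ((S c × ¬ S b × ¬ S d) ⊎ (¬ S c × S b × S d))

  module _ (alternation-free : Alternation-free) where

    Separates⇒¬ClumpAt : {v : Word n} {i j q : Fin n} → IsPerm v → Adjacent i j → Separates v →
                         a < q → q F.≤ e → PairAt v i j a q → ¬ ClumpAt v i j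
    Separates⇒¬ClumpAt {v = v} {i} {j} {q} perm adj sep a<q q≤e pair C
      with fromClumpAt {v = v} C
    ... | V@(clump _ b c d _ pair' o1 o2 o3 o4 sides)
      with PairAt-unique {v = v} pair' (ClumpView.lo<hi V) pair a<q
    ... | refl , refl = alternation-free o1 o2 o3 (NP.<-≤-trans o4 q≤e) (classify sides)
      where
      below-q : ∀ {u} → u < q → u F.≤ e
      below-q u<q = NP.<⇒≤ (NP.<-≤-trans u<q q≤e)
      left⇒S : ∀ {u} → a < u → u < q → LeftOf v i u → S u
      left⇒S {u} a<u u<q left with S? u
      ... | yes s = s
      ... | no ¬s = ⊥-elim (Precedes-asym {v = v} perm
              (LeftOf⇒Precedes {v = v} adj (PairAt-lo {v = v} pair) left)
              (proj₂ (sep a<u (below-q u<q)) ¬s))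
      right⇒¬S : ∀ {u} → a < u → u < q → RightOf v j u → ¬ S u
      right⇒¬S a<u u<q right s = Precedes-asym {v = v} perm
        (RightOf⇒Precedes {v = v} adj (PairAt-lo {v = v} pair) right)
        (proj₁ (sep a<u (below-q u<q)) s)
      a<c = NP.<-trans o1 o2
      a<d = NP.<-trans a<c o3
      b<q = NP.<-trans o2 (NP.<-trans o3 o4)
      c<q = NP.<-trans o3 o4
      classify : Sides v i j b c d → (S c × ¬ S b × ¬ S d) ⊎ (¬ S c × S b × S d)
      classify (inj₁ (lc , rb , rd)) =
        inj₁ (left⇒S a<c c<q lc , right⇒¬S o1 b<q rb , right⇒¬S a<d o4 rd)
      classify (inj₂ (rc , lb , ld)) =
        inj₂ (right⇒¬S a<c c<q rc , left⇒S o1 b<q lb , left⇒S a<d o4 ld)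

    Separates-Step : {v w : Word n} → IsPerm v → Separates v → Step v w → Separates w
    Separates-Step {v = v} {w} perm sep st {q} a<q q≤e with Step⇒Swapped {v = v} {w} st
    ... | i , j , C , sw = before , after
      where
      adj : Adjacent i j
      adj = Swapped.adjacent sw
      before : S q → Precedes w q a
      before s = Precedes-Swapped sw (proj₁ (sep a<q q≤e) s)
        λ (q≡vi , a≡vj) →
          Separates⇒¬ClumpAt {v = v} perm adj sep a<q q≤e (inj₂ (sym q≡vi , sym a≡vj)) C
      after : ¬ S q → Precedes w a q
      after ¬s = Precedes-Swapped sw (proj₂ (sep a<q q≤e) ¬s)
        λ (a≡vi , q≡vj) →
          Separates⇒¬ClumpAt {v = v} perm adj sep a<q q≤e (inj₁ (sym a≡vi , sym q≡vj)) C

    Separates-SameRect : {v w : Word n} → SameRect v w → IsPerm v → Separates v → Separates w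
    Separates-SameRect v~w perm sep =
      proj₂ (SameRect-invariant (λ u → IsPerm u × Separates u)
        (λ {u} {u'} st (perm-u , sep-u) →
          Step-isPerm {v = u} {u'} st perm-u , Separates-Step {v = u} {u'} perm-u sep-u st)
        v~w (perm , sep))

module _ {v u : Word n} {i j : Fin n} (perm : IsPerm v) (adj : Adjacent i j) (¬clump : ¬ ClumpAt v i j)
         (v~u : SameRect v u) where

  private
    pair-order-invariant : ∀ {a e} → a < e → PairAt v i j a e →
                           (¬ Precedes v e a → Precedes u a e) × (Precedes v e a → Precedes u e a)
    pair-order-invariant {a} {e} a<e pair = proj₂ (sep-u a<e NP.≤-refl) , proj₁ (sep-u a<e NP.≤-refl)
      where
      open SeparatedBy a e (λ q → Precedes v q a) (λ q → Precedes? v q a)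
      a≢ : ∀ {q} → a < q → q ≢ a
      a≢ a<q = ≢-sym (FP.<⇒≢ a<q)
      sep-v : Separates v
      sep-v a<q _ = id , ¬Precedes⇒Precedes {v = v} perm (a≢ a<q)
      between : ∀ {q} → a < q → q < e → q ≢ lookup v i × q ≢ lookup v j
      between = PairAt-between {v = v} pair
      lo-at : lookup v i ≡ a ⊎ lookup v j ≡ a
      lo-at = PairAt-lo {v = v} pair
      left : ∀ {q} → a < q → q < e → Precedes v q a → LeftOf v i q
      left a<q q<e = Precedes⇒LeftOf {v = v} perm adj lo-at (proj₁ (between a<q q<e))
      right : ∀ {q} → a < q → q < e → ¬ Precedes v q a → RightOf v j q
      right a<q q<e ¬qa = Precedes⇒RightOf {v = v} perm adj lo-at (proj₂ (between a<q q<e))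
                            (¬Precedes⇒Precedes {v = v} perm (a≢ a<q) ¬qa)
      alternation-free : Alternation-free
      alternation-free {b} {c} {d} a<b b<c c<d d<e alternation =
        ¬clump (toClumpAt {v = v} (clump a b c d e pair a<b b<c c<d d<e (sides alternation)))
        where
        a<c = NP.<-trans a<b b<c
        a<d = NP.<-trans a<c c<d
        c<e = NP.<-trans c<d d<e
        b<e = NP.<-trans b<c c<e
        sides : (Precedes v c a × ¬ Precedes v b a × ¬ Precedes v d a) ⊎
                (¬ Precedes v c a × Precedes v b a × Precedes v d a) → Sides v i j b c d
        sides (inj₁ (sc , ¬sb , ¬sd)) = inj₁ (left a<c c<e sc , right a<b b<e ¬sb , right a<d d<e ¬sd)
        sides (inj₂ (¬sc , sb , sd)) = inj₂ (right a<c c<e ¬sc , left a<b b<e sb , left a<d d<e sd)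
      sep-u : Separates u
      sep-u = Separates-SameRect alternation-free v~u perm sep-v

  nonClump-order-invariant : Precedes u (lookup v i) (lookup v j)
  nonClump-order-invariant with FP.<-cmp (lookup v i) (lookup v j)
  ... | tri< vi<vj _ _ = proj₁ (pair-order-invariant vi<vj (inj₁ (refl , refl)))
                           (Precedes-asym {v = v} perm (precedes-at {v = v} (Adjacent⇒< adj)))
  ... | tri≈ _ vi≡vj _ = ⊥-elim (FP.<⇒≢ (Adjacent⇒< adj) (IsPerm⇒injective {v = v} perm vi≡vj))
  ... | tri> _ _ vj<vi =
    proj₂ (pair-order-invariant vj<vi (inj₂ (refl , refl))) (precedes-at {v = v} (Adjacent⇒< adj))

Swapped-SameRect⇒ClumpAt : {v w : Word n} {i j : Fin n} → IsPerm v → Swapped v w i j → SameRect v w → ClumpAt v i j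
Swapped-SameRect⇒ClumpAt {v = v} {w} {i} {j} perm sw v~w with ClumpAt? v i j
... | yes C = C
... | no ¬C = ⊥-elim (Precedes-asym {v = w} (Swapped-isPerm sw perm)
                (nonClump-order-invariant {v = v} perm adjacent ¬C v~w)
                (i , j , Adjacent⇒< adjacent , at-i , at-j))
  where open Swapped sw

adjacent-order⇒≡ : {w y : Word n} → IsPerm y → (∀ {i j} → Adjacent i j → Precedes y (lookup w i) (lookup w j)) →
                   w ≡ y
adjacent-order⇒≡ {n = n} {w = w} {y} perm-y ordered =
  Pointwise-≡⇒≡ (ext λ k → trans (sym (y∘position k)) (cong (lookup y) (position≡id k)))
  where
  position : Fin n → Fin n
  position k = proj₁ (perm-y (lookup w k))
  y∘position : ∀ k → lookup y (position k) ≡ lookup w k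
  y∘position k = proj₂ (perm-y (lookup w k))
  position-adjacent : ∀ {i j} → Adjacent i j → position i < position j
  position-adjacent {i} {j} adj with ordered adj
  ... | p , q , p<q , yp , yq
    with IsPerm⇒injective {v = y} perm-y (trans yp (sym (y∘position i)))
       | IsPerm⇒injective {v = y} perm-y (trans yq (sym (y∘position j)))
  ... | refl | refl = p<q
  position≡id : ∀ k → position k ≡ k
  position≡id = adjacent-increasing⇒id position position-adjacent

≤w⇒≡⊎inverted-ascent : {w y : Word n} → IsPerm w → IsPerm y → w ≤w y →
                       w ≡ y ⊎ ∃₂ λ i j → Adjacent i j × Inv y (lookup w i) (lookup w j)
≤w⇒≡⊎inverted-ascent {w = w} {y} perm-w perm-y w≤y
  with FP.any? (λ i → FP.any? λ j →
         Adjacent? i j ×-dec (lookup w i FP.<? lookup w j) ×-dec Precedes? y (lookup w j) (lookup w i))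
... | yes (i , j , adj , inv) = inj₂ (i , j , adj , inv)
... | no none = inj₁ (adjacent-order⇒≡ perm-y ordered)
  where
  ordered : ∀ {i j} → Adjacent i j → Precedes y (lookup w i) (lookup w j)
  ordered {i} {j} adj with FP.<-cmp (lookup w i) (lookup w j)
  ... | tri< asc _ _ =
    ¬Precedes⇒Precedes {v = y} perm-y (≢-sym (FP.<⇒≢ asc)) λ y-ji → none (i , j , adj , asc , y-ji)
  ... | tri≈ _ wi≡wj _ = ⊥-elim (FP.<⇒≢ (Adjacent⇒< adj) (IsPerm⇒injective {v = w} perm-w wi≡wj))
  ... | tri> _ _ desc = proj₂ (w≤y _ _ (desc , precedes-at {v = w} (Adjacent⇒< adj)))

-- Convexity of classes

module _ {u y : Word n} (perm-u : IsPerm u) (perm-y : IsPerm y) (u~y : SameRect u y) where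

  -- Downwards from y: swapping an ascent of w inverted in y gives w' in the class by induction, and
  -- the swap back is a clump swap, since otherwise the order of that pair would be constant on the
  -- class, contradicting u ≤w w.
  private
    convex : ∀ w → Acc Higher w → IsPerm w → u ≤w w → w ≤w y → SameRect u w
    convex w (acc higher) perm-w u≤w w≤y with ≤w⇒≡⊎inverted-ascent {w = w} {y} perm-w perm-y w≤y
    ... | inj₁ refl = u~y
    ... | inj₂ (i , j , adj , asc , y-ji) = swap-back (ClumpAt? w' i j)
      where
      w' : Word n
      w' = swap w i j
      sw : Swapped w w' i j
      sw = swap-Swapped w adj
      u~w' : SameRect u w'
      u~w' = convex w' (higher (Swapped-Higher {v = w} perm-w sw asc)) (Swapped-isPerm sw perm-w)
               (≤w-trans {u = u} {w} {w'} u≤w (≤w-Swapped sw asc))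
               (≤w-Swapped-below sw {y = y} w≤y (asc , y-ji))
      swap-back : Dec (ClumpAt w' i j) → SameRect u w
      swap-back (yes C) = SameRect-trans u~w' (SameRect-step (Swapped⇒Step {v = w'} C (Swapped-sym sw)))
      swap-back (no ¬C) = ⊥-elim (¬Inv-adjacent {v = w} perm-w adj (u≤w _ _ (asc , u-ji)))
        where
        u-ji : Precedes u (lookup w j) (lookup w i)
        u-ji = subst₂ (Precedes u) (Swapped.at-i sw) (Swapped.at-j sw)
                 (nonClump-order-invariant {v = w'} (Swapped-isPerm sw perm-w) adj ¬C (SameRect-sym u~w'))

  SameRect-convex : ∀ {w} → IsPerm w → u ≤w w → w ≤w y → SameRect u w
  SameRect-convex {w} = convex w (Higher-wellFounded w)

-- Climbing along clump ascents

ClumpAscent : Word n → Fin n → Fin n → Set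
ClumpAscent v i j = Adjacent i j × lookup v i < lookup v j × ClumpAt v i j

ClumpAscentFree : (Fin n → Fin n → Set) → Word n → Set
ClumpAscentFree Allowed z = ∀ {i j} → Allowed i j → ¬ ClumpAscent z i j

module _ (Allowed : Fin n → Fin n → Set) (Allowed? : ∀ i j → Dec (Allowed i j)) (Q : Word n → Set)
         (Q-swap : ∀ {v i j} → Q v → Adjacent i j → Allowed i j → Q (swap v i j)) where

  private
    climb′ : ∀ v → Acc Higher v → IsPerm v → Q v →
             ∃ λ z → SameRect v z × IsPerm z × Q z × ClumpAscentFree Allowed z
    climb′ v (acc higher) perm-v q-v with FP.any? (λ i → FP.any? λ j →
      Allowed? i j ×-dec Adjacent? i j ×-dec (lookup v i FP.<? lookup v j) ×-dec ClumpAt? v i j)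
    ... | no none =
      v , EqClosure.reflexive Step , perm-v , q-v , λ allowed (adj , asc , C) → none (_ , _ , allowed , adj , asc , C)
    ... | yes (i , j , allowed , adj , asc , C)
      with climb′ (swap v i j) (higher (Swapped-Higher {v = v} perm-v sw asc))
                  (Swapped-isPerm sw perm-v) (Q-swap q-v adj allowed)
      where sw = swap-Swapped v adj
    ... | z , v'~z , rest =
      z , SameRect-trans (SameRect-step (Swapped⇒Step {v = v} C (swap-Swapped v adj))) v'~z , rest

  climb : ∀ v → IsPerm v → Q v → ∃ λ z → SameRect v z × IsPerm z × Q z × ClumpAscentFree Allowed z
  climb v = climb′ v (Higher-wellFounded v)

-- The top of a class

module _ {y : Word n} (perm-y : IsPerm y) where

  record Below (v : Word n) : Set where
    field
      perm : IsPerm v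
      ~y : SameRect v y
      ≤y : v ≤w y
  open Below

  Below-Swapped : ∀ {v w i j} → Below v → Swapped v w i j → Inv y (lookup v i) (lookup v j) → Below w
  Below-Swapped {v} {w} below sw inv =
    record { perm = perm-w ; ~y = SameRect-trans (SameRect-sym v~w) (~y below) ; ≤y = w≤y }
    where
    perm-w : IsPerm w
    perm-w = Swapped-isPerm sw (perm below)
    w≤y : w ≤w y
    w≤y = ≤w-Swapped-below sw {y = y} (≤y below) inv
    v~w : SameRect v w
    v~w = SameRect-convex (perm below) perm-y (~y below) perm-w (≤w-Swapped sw (proj₁ inv)) w≤y

  Below-SameRect : ∀ {v w} → Below v → Below w → SameRect v w
  Below-SameRect bv bw = SameRect-trans (~y bv) (SameRect-sym (~y bw))

  Uninverted : Word n → Fin n → Fin n → Set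
  Uninverted v i j = ClumpAscent v i j × Precedes y (lookup v i) (lookup v j)

  NoUninverted : Word n → Set
  NoUninverted v = Below v → ∀ {i j} → ¬ Uninverted v i j

  NoUninvertedAbove : Word n → Set
  NoUninvertedAbove v = ∀ {w} → Higher w v → NoUninverted w

  Uninverted-apart : ∀ {v i j k k'} → NoUninvertedAbove v → Below v → Uninverted v i j →
                     Adjacent k k' → Inv y (lookup v k) (lookup v k') → k ≢ i → k ≢ j → k' ≢ i → k' ≢ j → ⊥
  Uninverted-apart {v} {i} {j} {k} {k'} hyp below ((adj , asc , C) , y-ij) adj' inv k≢i k≢j k'≢i k'≢j =
    hyp (Swapped-Higher {v = v} (perm below) sw (proj₁ inv)) (Below-Swapped below sw inv)
      ((adj , subst₂ _<_ (sym wi) (sym wj) asc , C') , subst₂ (Precedes y) (sym wi) (sym wj) y-ij)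
    where
    w : Word n
    w = swap v k k'
    sw : Swapped v w k k'
    sw = swap-Swapped v adj'
    wi : lookup w i ≡ lookup v i
    wi = Swapped.elsewhere sw i (≢-sym k≢i) (≢-sym k'≢i)
    wj : lookup w j ≡ lookup v j
    wj = Swapped.elsewhere sw j (≢-sym k≢j) (≢-sym k'≢j)
    C' : ClumpAt w i j
    C' = ClumpAt-transport-ascent {v = v} {w} C asc wi wj
           (λ _ _ → LeftOf-Swapped sw k≢i k'≢i) (λ _ _ → RightOf-Swapped sw k≢j k'≢j)

  -- Write a, e, f for the values at i, j, l.
  Uninverted-right : ∀ {v i j l} → NoUninvertedAbove v → Below v → Uninverted v i j →
                     Adjacent j l → Inv y (lookup v j) (lookup v l) → ⊥
  Uninverted-right {v} {i} {j} {l} hyp below ((adj , asc , C) , y-ij) adj-jl inv-jl@(asc-jl , _) =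
    by-order-in-y (Precedes-total {v = y} perm-y (FP.<⇒≢ a<f))
    where
    a<f = NP.<-trans asc asc-jl
    i<j = Adjacent⇒< adj
    j<l = Adjacent⇒< adj-jl
    v₂ : Word n
    v₂ = swap v j l
    sw₂ : Swapped v v₂ j l
    sw₂ = swap-Swapped v adj-jl
    below₂ : Below v₂
    below₂ = Below-Swapped below sw₂ inv-jl
    higher₂ : Higher v₂ v
    higher₂ = Swapped-Higher {v = v} (perm below) sw₂ asc-jl
    v₂i : lookup v₂ i ≡ lookup v i
    v₂i = Swapped-left sw₂ i<j
    asc₂ : lookup v₂ i < lookup v₂ j
    asc₂ = subst₂ _<_ (sym v₂i) (sym (Swapped.at-i sw₂)) a<f
    v~v₂ : SameRect v v₂
    v~v₂ = Below-SameRect below below₂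
    by-order-in-y : Precedes y (lookup v i) (lookup v l) ⊎ Precedes y (lookup v l) (lookup v i) → ⊥
    -- y orders the values as f, a, e: swap a to the right of f; the clump a, e reappears at j, l.
    by-order-in-y (inj₂ y-fa) =
      hyp (NP.<-trans (Swapped-Higher {v = v₂} (perm below₂) sw₃ asc₂) higher₂) (Below-Swapped below₂ sw₃ inv₃)
        ((adj-jl , subst₂ _<_ (sym v₃j) (sym v₃l) asc , C₃) , subst₂ (Precedes y) (sym v₃j) (sym v₃l) y-ij)
      where
      v₃ : Word n
      v₃ = swap v₂ i j
      sw₃ : Swapped v₂ v₃ i j
      sw₃ = swap-Swapped v₂ adj
      inv₃ : Inv y (lookup v₂ i) (lookup v₂ j)
      inv₃ = asc₂ , subst₂ (Precedes y) (sym (Swapped.at-i sw₂)) (sym v₂i) y-fa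
      v₃j : lookup v₃ j ≡ lookup v i
      v₃j = trans (Swapped.at-j sw₃) v₂i
      v₃l : lookup v₃ l ≡ lookup v j
      v₃l = trans (Swapped-right sw₃ j<l) (Swapped.at-j sw₂)
      left : ∀ {u} → LeftOf v i u → LeftOf v₃ j u
      left (p , p<i , vp) =
        p , p<j , trans (Swapped-left sw₃ p<i) (trans (Swapped-left sw₂ p<j) vp)
        where p<j = NP.<-trans p<i i<j
      right : ∀ {u} → u < lookup v j → RightOf v j u → RightOf v₃ l u
      right u<e (p , j<p , vp) = p , l<p , trans (Swapped-right sw₃ j<p) (trans (Swapped-right sw₂ l<p) vp)
        where
        l<p : l < p
        l<p = Adjacent-after adj-jl j<p λ { refl → NP.<-asym asc-jl (subst (_< lookup v j) (sym vp) u<e) }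
      C₃ : ClumpAt v₃ j l
      C₃ = ClumpAt-transport-ascent {v = v} {v₃} C asc v₃j v₃l (λ _ _ → left) (λ _ → right)
    -- y orders the values as a, f: the swap of e, f stays in the class, so e, f is a clump, and then
    -- a, f is a clump of v₂.
    by-order-in-y (inj₁ y-af)
      with ClumpAt-ascent-left {v = v} C asc
         | ClumpAt-ascent-left {v = v} (Swapped-SameRect⇒ClumpAt (perm below) sw₂ v~v₂) asc-jl
    ... | b , a<b , b<e , (q , q<i , vq) | d , e<d , d<f , (p , p<j , vp) =
      hyp higher₂ below₂
        ((adj , asc₂ , toClumpAt {v = v₂} C₂) , subst₂ (Precedes y) (sym v₂i) (sym (Swapped.at-i sw₂)) y-af)
      where
      p<i : p < i
      p<i = Adjacent-before adj p<j λ { refl → NP.<-asym asc (subst (lookup v j <_) (sym vp) e<d) }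
      C₂ : ClumpView v₂ i j
      C₂ = clump (lookup v i) b (lookup v j) d (lookup v l) (inj₁ (v₂i , Swapped.at-i sw₂)) a<b b<e e<d d<f
             (inj₂ ((l , j<l , Swapped.at-j sw₂) ,
                    (q , q<i , trans (Swapped-left sw₂ (NP.<-trans q<i i<j)) vq) ,
                    (p , p<i , trans (Swapped-left sw₂ p<j) vp)))

  -- Write g, a, e for the values at h, i, j.
  Uninverted-left : ∀ {v h i j} → NoUninvertedAbove v → Below v → Uninverted v i j →
                    Adjacent h i → Inv y (lookup v h) (lookup v i) → ⊥
  Uninverted-left {v} {h} {i} {j} hyp below ((adj , asc , C) , y-ij) adj-hi inv-hi@(asc-hi , _) =
    by-order-in-y (Precedes-total {v = y} perm-y (FP.<⇒≢ g<e))
    where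
    g<e = NP.<-trans asc-hi asc
    i<j = Adjacent⇒< adj
    h<i = Adjacent⇒< adj-hi
    v₂ : Word n
    v₂ = swap v h i
    sw₂ : Swapped v v₂ h i
    sw₂ = swap-Swapped v adj-hi
    below₂ : Below v₂
    below₂ = Below-Swapped below sw₂ inv-hi
    higher₂ : Higher v₂ v
    higher₂ = Swapped-Higher {v = v} (perm below) sw₂ asc-hi
    v₂j : lookup v₂ j ≡ lookup v j
    v₂j = Swapped-right sw₂ i<j
    asc₂ : lookup v₂ i < lookup v₂ j
    asc₂ = subst₂ _<_ (sym (Swapped.at-j sw₂)) (sym v₂j) g<e
    v~v₂ : SameRect v v₂
    v~v₂ = Below-SameRect below below₂
    by-order-in-y : Precedes y (lookup v h) (lookup v j) ⊎ Precedes y (lookup v j) (lookup v h) → ⊥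
    -- y orders the values as a, e, g: swap g to the right of e; the clump a, e reappears at h, i.
    by-order-in-y (inj₂ y-eg) =
      hyp (NP.<-trans (Swapped-Higher {v = v₂} (perm below₂) sw₃ asc₂) higher₂) (Below-Swapped below₂ sw₃ inv₃)
        ((adj-hi , subst₂ _<_ (sym v₃h) (sym v₃i) asc , C₃) , subst₂ (Precedes y) (sym v₃h) (sym v₃i) y-ij)
      where
      v₃ : Word n
      v₃ = swap v₂ i j
      sw₃ : Swapped v₂ v₃ i j
      sw₃ = swap-Swapped v₂ adj
      inv₃ : Inv y (lookup v₂ i) (lookup v₂ j)
      inv₃ = asc₂ , subst₂ (Precedes y) (sym v₂j) (sym (Swapped.at-j sw₂)) y-eg
      v₃h : lookup v₃ h ≡ lookup v i
      v₃h = trans (Swapped-left sw₃ h<i) (Swapped.at-i sw₂)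
      v₃i : lookup v₃ i ≡ lookup v j
      v₃i = trans (Swapped.at-i sw₃) v₂j
      left : ∀ {u} → lookup v i < u → LeftOf v i u → LeftOf v₃ h u
      left a<u (p , p<i , vp) = p , p<h , trans (Swapped-left sw₃ p<i) (trans (Swapped-left sw₂ p<h) vp)
        where
        p<h : p < h
        p<h = Adjacent-before adj-hi p<i λ { refl → NP.<-asym asc-hi (subst (lookup v i <_) (sym vp) a<u) }
      right : ∀ {u} → RightOf v j u → RightOf v₃ i u
      right (p , j<p , vp) =
        p , i<p , trans (Swapped-right sw₃ j<p) (trans (Swapped-right sw₂ i<p) vp)
        where i<p = NP.<-trans i<j j<p
      C₃ : ClumpAt v₃ h i
      C₃ = ClumpAt-transport-ascent {v = v} {v₃} C asc v₃h v₃i (λ a<u _ → left a<u) (λ _ _ → right)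
    -- y orders the values as g, e: the swap of g, a stays in the class, so g, a is a clump, and then
    -- g, e is a clump of v₂.
    by-order-in-y (inj₁ y-ge)
      with ClumpAt-ascent-right {v = v} (Swapped-SameRect⇒ClumpAt (perm below) sw₂ v~v₂) asc-hi
         | ClumpAt-ascent-right {v = v} C asc
    ... | b , g<b , b<a , (p , i<p , vp) | d , a<d , d<e , (q , j<q , vq) =
      hyp higher₂ below₂
        ((adj , asc₂ , toClumpAt {v = v₂} C₂) , subst₂ (Precedes y) (sym (Swapped.at-j sw₂)) (sym v₂j) y-ge)
      where
      j<p : j < p
      j<p = Adjacent-after adj i<p λ { refl → NP.<-asym asc (subst (_< lookup v i) (sym vp) b<a) }
      C₂ : ClumpView v₂ i j
      C₂ = clump (lookup v h) b (lookup v i) d (lookup v j) (inj₁ (Swapped.at-j sw₂ , v₂j)) g<b b<a a<d d<e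
             (inj₁ ((h , h<i , Swapped.at-i sw₂) ,
                    (p , j<p , trans (Swapped-right sw₂ i<p) vp) ,
                    (q , j<q , trans (Swapped-right sw₂ (NP.<-trans i<j j<q)) vq)))

  module _ (free : ClumpAscentFree (λ _ _ → ⊤) y) where

    -- Below y, an ascent inverted in y exists unless v = y; next to or apart from an uninverted
    -- clump ascent, it yields an uninverted clump ascent of a higher word of the class.
    NoUninvertedAbove⇒NoUninverted : ∀ {v} → NoUninvertedAbove v → NoUninverted v
    NoUninvertedAbove⇒NoUninverted {v} hyp below {i} {j} unv@((adj , asc , C) , y-ij)
      with ≤w⇒≡⊎inverted-ascent {w = v} {y} (perm below) perm-y (≤y below)
    ... | inj₁ refl = free tt (adj , asc , C)
    ... | inj₂ (k , k' , adj' , inv) with k ≟ i | k ≟ j | k' ≟ i | k' ≟ j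
    ... | yes refl | _ | _ | _ with Adjacent-injectiveʳ adj adj'
    ...   | refl = Precedes-asym {v = y} perm-y y-ij (proj₂ inv)
    NoUninvertedAbove⇒NoUninverted hyp below unv | inj₂ (k , k' , adj' , inv) | no _ | yes refl | _ | _ =
      Uninverted-right hyp below unv adj' inv
    NoUninvertedAbove⇒NoUninverted hyp below unv | inj₂ (k , k' , adj' , inv) | no _ | no _ | yes refl | _ =
      Uninverted-left hyp below unv adj' inv
    NoUninvertedAbove⇒NoUninverted hyp below ((adj , _) , _)
      | inj₂ (k , k' , adj' , inv) | no k≢i | no _ | no _ | yes refl =
      k≢i (sym (Adjacent-injectiveˡ adj adj'))
    NoUninvertedAbove⇒NoUninverted hyp below unv
      | inj₂ (k , k' , adj' , inv) | no k≢i | no k≢j | no k'≢i | no k'≢j =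
      Uninverted-apart hyp below unv adj' inv k≢i k≢j k'≢i k'≢j

    Below⇒¬Uninverted : ∀ v → NoUninverted v
    Below⇒¬Uninverted v = go v (Higher-wellFounded v)
      where
      go : ∀ v → Acc Higher v → NoUninverted v
      go v (acc higher) = NoUninvertedAbove⇒NoUninverted (λ v'-higher → go _ (higher v'-higher))

    Below-Step : ∀ {v w} → Step v w → Below v → Below w
    Below-Step {v} {w} st below with Step⇒Swapped {v = v} {w} st
    ... | i , j , C , sw with FP.<-cmp (lookup v i) (lookup v j)
    ... | tri< asc _ _ = Below-Swapped below sw (asc , y-ji)
      where
      y-ji : Precedes y (lookup v j) (lookup v i)
      y-ji = ¬Precedes⇒Precedes {v = y} perm-y (FP.<⇒≢ asc)
               λ y-ij → Below⇒¬Uninverted v below ((Swapped.adjacent sw , asc , C) , y-ij)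
    ... | tri≈ _ vi≡vj _ =
      ⊥-elim (FP.<⇒≢ (Adjacent⇒< (Swapped.adjacent sw)) (IsPerm⇒injective {v = v} (perm below) vi≡vj))
    ... | tri> _ _ desc = record
      { perm = Swapped-isPerm sw (perm below)
      ; ~y = SameRect-trans (SameRect-sym (SameRect-step st)) (~y below)
      ; ≤y = λ a b inv → ≤y below a b (w≤v inv)
      }
      where
      w≤v : ∀ {a b} → Inv w a b → Inv v a b
      w≤v inv with Inv-Swapped⁻ sw inv
      ... | inj₁ inv-v = inv-v
      ... | inj₂ (refl , refl) = ⊥-elim (NP.<-asym desc (proj₁ inv))

    top-maximum : ∀ {w} → SameRect y w → w ≤w y
    top-maximum y~w = ≤y (SameRect-invariant Below (λ {v} {w} → Below-Step {v} {w}) y~w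
                           (record { perm = perm-y ; ~y = EqClosure.reflexive Step ; ≤y = ≤w-refl {v = y} }))

-- The maximum of a prefix fiber

PrefixIs-Swapped : {v w : Word n} {i j : Fin n} (T : Subset n) → Swapped v w i j →
                   (toℕ i N.< ∣ T ∣ ⇔ toℕ j N.< ∣ T ∣) → PrefixIs T v → PrefixIs T w
PrefixIs-Swapped {i = i} {j} T sw i⇔j prefix p with p ≟ i | p ≟ j
... | yes refl | _ rewrite Swapped.at-i sw = ⇔.trans i⇔j (prefix j)
... | no _ | yes refl rewrite Swapped.at-j sw = ⇔.trans (⇔.sym i⇔j) (prefix i)
... | no p≢i | no p≢j rewrite Swapped.elsewhere sw p p≢i p≢j = prefix p

PrefixIs-closed : {v : Word n} (T : Subset n) → PrefixIs T v → ∀ {p q} → Precedes v p q → q ∈ T → p ∈ T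
PrefixIs-closed T prefix (i , j , i<j , vi , vj) q∈T =
  subst (_∈ T) vi (Equivalence.to (prefix i) (NP.<-trans i<j j<∣T∣))
  where
  j<∣T∣ : toℕ j N.< ∣ T ∣
  j<∣T∣ = Equivalence.from (prefix j) (subst (_∈ T) (sym vj) q∈T)

module _ {x : Word n} (T : Subset n) (good : Good x T) where

  private
    w₀ : Word n
    w₀ = proj₁ good
    perm₀ : IsPerm w₀
    perm₀ = proj₁ (proj₂ good)
    x~w₀ : SameRect x w₀
    x~w₀ = proj₁ (proj₂ (proj₂ good))
    prefix₀ : PrefixIs T w₀
    prefix₀ = proj₂ (proj₂ (proj₂ good))
    top : ∃ λ y → SameRect w₀ y × IsPerm y × ⊤ × ClumpAscentFree (λ _ _ → ⊤) y
    top = climb (λ _ _ → ⊤) (λ _ _ → yes tt) (λ _ → ⊤) (λ _ _ _ → tt) w₀ perm₀ tt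
    y : Word n
    y = proj₁ top
    perm-y : IsPerm y
    perm-y = proj₁ (proj₂ (proj₂ top))
    x~y : SameRect x y
    x~y = SameRect-trans x~w₀ (proj₁ (proj₂ top))
    below-y : ∀ {w} → SameRect x w → w ≤w y
    below-y x~w = top-maximum perm-y (proj₂ (proj₂ (proj₂ (proj₂ top))))
                    (SameRect-trans (SameRect-sym x~y) x~w)

    SameBlock : Fin n → Fin n → Set
    SameBlock i j = toℕ j N.< ∣ T ∣ ⊎ ∣ T ∣ N.≤ toℕ i

    SameBlock? : ∀ i j → Dec (SameBlock i j)
    SameBlock? i j = (toℕ j NP.<? ∣ T ∣) ⊎-dec (∣ T ∣ NP.≤? toℕ i)

    SameBlock-prefix : ∀ {i j} → i < j → SameBlock i j → toℕ i N.< ∣ T ∣ ⇔ toℕ j N.< ∣ T ∣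
    SameBlock-prefix i<j (inj₁ j<k) = mk⇔ (λ _ → j<k) (λ _ → NP.<-trans i<j j<k)
    SameBlock-prefix i<j (inj₂ k≤i) = mk⇔ (λ i<k → ⊥-elim (NP.<-irrefl refl (NP.<-≤-trans i<k k≤i)))
                                          (λ j<k → ⊥-elim (NP.<-irrefl refl (NP.<-trans (NP.<-≤-trans j<k k≤i) i<j)))

    block-climb : ∃ λ z → SameRect w₀ z × IsPerm z × PrefixIs T z × ClumpAscentFree SameBlock z
    block-climb = climb SameBlock SameBlock? (PrefixIs T)
                    (λ {v} prefix adj same →
                      PrefixIs-Swapped T (swap-Swapped v adj) (SameBlock-prefix (Adjacent⇒< adj) same) prefix)
                    w₀ perm₀ prefix₀
    z : Word n
    z = proj₁ block-climb
    x~z : SameRect x z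
    x~z = SameRect-trans x~w₀ (proj₁ (proj₂ block-climb))
    perm-z : IsPerm z
    perm-z = proj₁ (proj₂ (proj₂ block-climb))
    prefix-z : PrefixIs T z
    prefix-z = proj₁ (proj₂ (proj₂ (proj₂ block-climb)))
    free-z : ClumpAscentFree SameBlock z
    free-z = proj₂ (proj₂ (proj₂ (proj₂ block-climb)))

    z-adjacent-in-y : ∀ {i j} → Adjacent i j → SameBlock i j → Precedes y (lookup z i) (lookup z j)
    z-adjacent-in-y {i} {j} adj same with FP.<-cmp (lookup z i) (lookup z j)
    ... | tri< asc _ _ =
      ¬Precedes⇒Precedes {v = y} perm-y (≢-sym (FP.<⇒≢ asc)) λ y-ji → free-z same (adj , asc , C y-ji)
      where
      sw : Swapped z (swap z i j) i j
      sw = swap-Swapped z adj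
      C : Precedes y (lookup z j) (lookup z i) → ClumpAt z i j
      C y-ji = Swapped-SameRect⇒ClumpAt perm-z sw
        (SameRect-convex perm-z perm-y (SameRect-trans (SameRect-sym x~z) x~y) (Swapped-isPerm sw perm-z)
          (≤w-Swapped sw asc) (≤w-Swapped-below sw {y = y} (below-y x~z) (asc , y-ji)))
    ... | tri≈ _ zi≡zj _ = ⊥-elim (FP.<⇒≢ (Adjacent⇒< adj) (IsPerm⇒injective {v = z} perm-z zi≡zj))
    ... | tri> _ _ desc = proj₂ (below-y x~z _ _ (desc , precedes-at {v = z} (Adjacent⇒< adj)))

    z-block-in-y : ∀ {p q} → p < q → SameBlock p q → Precedes y (lookup z p) (lookup z q)
    z-block-in-y {p} {q} p<q same =
      adjacent-chain (λ {i j k} → Precedes-trans {v = y} perm-y) p<q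
        λ adj p≤i j≤q → z-adjacent-in-y adj (narrow p≤i j≤q same)
      where
      narrow : ∀ {i j} → p F.≤ i → j F.≤ q → SameBlock p q → SameBlock i j
      narrow _ j≤q (inj₁ q<k) = inj₁ (NP.≤-<-trans j≤q q<k)
      narrow p≤i _ (inj₂ k≤p) = inj₂ (NP.≤-trans k≤p p≤i)

    z-maximum : ∀ w → FiberPrefix x T w → w ≤w z
    z-maximum w (perm-w , x~w , prefix-w) a b (a<b , w-ba) with Precedes-total {v = z} perm-z (FP.<⇒≢ a<b)
    ... | inj₂ z-ba = a<b , z-ba
    ... | inj₁ z-ab = ⊥-elim (Precedes-asym {v = y} perm-y (y-ab z-ab) (proj₂ (below-y x~w a b (a<b , w-ba))))
      where
      y-ab : Precedes z a b → Precedes y a b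
      y-ab (qa , qb , qa<qb , za , zb) with a ∈? T | b ∈? T
      ... | yes a∈T | no b∉T = ⊥-elim (b∉T (PrefixIs-closed {v = w} T prefix-w w-ba a∈T))
      ... | no a∉T | yes b∈T = ⊥-elim (a∉T (PrefixIs-closed {v = z} T prefix-z z-ab b∈T))
      ... | yes _ | yes b∈T = subst₂ (Precedes y) za zb
            (z-block-in-y qa<qb (inj₁ (Equivalence.from (prefix-z qb) (subst (_∈ T) (sym zb) b∈T))))
      ... | no a∉T | no _ = subst₂ (Precedes y) za zb
            (z-block-in-y qa<qb (inj₂ (NP.≮⇒≥ λ qa<∣T∣ →
              a∉T (subst (_∈ T) za (Equivalence.to (prefix-z qa) qa<∣T∣)))))

  FiberPrefix-maximum : ∃ λ z → IsMaxOf (FiberPrefix x T) z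
  FiberPrefix-maximum = z , (perm-z , x~z , prefix-z) , z-maximum

-- Reversal of values

lookup-rv : (v : Word n) (i : Fin n) → lookup (rv v) i ≡ opposite (lookup v i)
lookup-rv v i = VP.lookup-map i opposite v

opposite-< : {a b : Fin n} → a < b → opposite b < opposite a
opposite-< {n} {a} {b} a<b rewrite FP.opposite-prop a | FP.opposite-prop b =
  NP.∸-monoʳ-< (N.s≤s a<b) (FP.toℕ<n b)

rv-involutive : (v : Word n) → rv (rv v) ≡ v
rv-involutive v = begin
  V.map opposite (V.map opposite v) ≡⟨ VP.map-∘ opposite opposite v ⟨
  V.map (opposite ∘ opposite) v     ≡⟨ VP.map-cong FP.opposite-involutive v ⟩
  V.map id v                        ≡⟨ VP.map-id v ⟩
  v                                 ∎
  where open ≡-Reasoning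

rv-isPerm : {v : Word n} → IsPerm v → IsPerm (rv v)
rv-isPerm {v = v} perm a with perm (opposite a)
... | i , vi = i , trans (lookup-rv v i) (trans (cong opposite vi) (FP.opposite-involutive a))

Precedes-rv : {v : Word n} {p q : Fin n} → Precedes v p q → Precedes (rv v) (opposite p) (opposite q)
Precedes-rv {v = v} (i , j , i<j , vi , vj) =
  i , j , i<j , trans (lookup-rv v i) (cong opposite vi) , trans (lookup-rv v j) (cong opposite vj)

ClumpAt-rv : {v : Word n} {i j : Fin n} → ClumpAt v i j → ClumpAt (rv v) i j
ClumpAt-rv {v = v} {i} {j} C with fromClumpAt {v = v} C
... | clump lo b c d hi pair o1 o2 o3 o4 sides =
  toClumpAt {v = rv v} (clump (opposite hi) (opposite d) (opposite c) (opposite b) (opposite lo) (rv-pair pair)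
    (opposite-< o4) (opposite-< o3) (opposite-< o2) (opposite-< o1) (rv-sides sides))
  where
  rv-at : ∀ {k u} → lookup v k ≡ u → lookup (rv v) k ≡ opposite u
  rv-at vk = trans (lookup-rv v _) (cong opposite vk)
  rv-pair : PairAt v i j lo hi → PairAt (rv v) i j (opposite hi) (opposite lo)
  rv-pair (inj₁ (vi , vj)) = inj₂ (rv-at vi , rv-at vj)
  rv-pair (inj₂ (vi , vj)) = inj₁ (rv-at vi , rv-at vj)
  left : ∀ {u} → LeftOf v i u → LeftOf (rv v) i (opposite u)
  left (k , k<i , vk) = k , k<i , rv-at vk
  right : ∀ {u} → RightOf v j u → RightOf (rv v) j (opposite u)
  right (k , j<k , vk) = k , j<k , rv-at vk
  rv-sides : Sides v i j b c d → Sides (rv v) i j (opposite d) (opposite c) (opposite b)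
  rv-sides (inj₁ (lc , rb , rd)) = inj₁ (left lc , right rd , right rb)
  rv-sides (inj₂ (rc , lb , ld)) = inj₂ (right rc , left ld , left lb)

Step-rv : {v w : Word n} → Step v w → Step (rv v) (rv w)
Step-rv {v = v} {w} st with Step⇒Swapped {v = v} {w} st
... | i , j , C , sw = Swapped⇒Step {v = rv v} {rv w} (ClumpAt-rv {v = v} C) record
  { adjacent = adjacent
  ; at-i = rv-cong at-i
  ; at-j = rv-cong at-j
  ; elsewhere = λ k k≢i k≢j → rv-cong (elsewhere k k≢i k≢j)
  }
  where
  open Swapped sw
  rv-cong : ∀ {k l} → lookup w k ≡ lookup v l → lookup (rv w) k ≡ lookup (rv v) l
  rv-cong {k} {l} e = trans (lookup-rv w k) (trans (cong opposite e) (sym (lookup-rv v l)))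

SameRect-rv : {v w : Word n} → SameRect v w → SameRect (rv v) (rv w)
SameRect-rv = EqClosure.gmap rv (λ {v} {w} → Step-rv {v = v} {w})

≤w-rv : {v w : Word n} → IsPerm v → IsPerm w → v ≤w w → rv w ≤w rv v
≤w-rv {v = v} {w} perm-v perm-w v≤w a b (a<b , rw-ba)
  with Precedes-total {v = v} perm-v (FP.<⇒≢ (opposite-< a<b))
... | inj₁ v-ba =
  a<b , subst₂ (Precedes (rv v)) (FP.opposite-involutive b) (FP.opposite-involutive a) (Precedes-rv {v = v} v-ba)
... | inj₂ v-ab = ⊥-elim (Precedes-asym {v = w} perm-w w-ba (proj₂ (v≤w _ _ (opposite-< a<b , v-ab))))
  where
  w-ba : Precedes w (opposite b) (opposite a)
  w-ba = subst (λ u → Precedes u (opposite b) (opposite a)) (rv-involutive w) (Precedes-rv {v = rv w} rw-ba)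

∈-rvSet : (T : Subset n) {a : Fin n} → opposite a ∈ rvSet T ⇔ a ∈ T
∈-rvSet T {a} = mk⇔
  (λ oa∈ → VP.lookup⇒[]= a T (trans (sym lookup-rvSet) (VP.[]=⇒lookup oa∈)))
  (λ a∈ → VP.lookup⇒[]= (opposite a) (rvSet T) (trans lookup-rvSet (VP.[]=⇒lookup a∈)))
  where
  lookup-rvSet : lookup (rvSet T) (opposite a) ≡ lookup T a
  lookup-rvSet =
    trans (VP.lookup∘tabulate (lookup T ∘ opposite) (opposite a)) (cong (lookup T) (FP.opposite-involutive a))

rvSet-involutive : (T : Subset n) → rvSet (rvSet T) ≡ T
rvSet-involutive T = Pointwise-≡⇒≡ (ext λ u → begin
  lookup (rvSet (rvSet T)) u         ≡⟨ VP.lookup∘tabulate _ u ⟩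
  lookup (rvSet T) (opposite u)      ≡⟨ VP.lookup∘tabulate _ (opposite u) ⟩
  lookup T (opposite (opposite u))   ≡⟨ cong (lookup T) (FP.opposite-involutive u) ⟩
  lookup T u                         ∎)
  where open ≡-Reasoning

module _ {A : Set} {P : A → Set} (P? : Decidable P) where

  count-swap : ∀ x y {m} (xs : Vec A m) → V.count P? (x V.∷ y V.∷ xs) ≡ V.count P? (y V.∷ x V.∷ xs)
  count-swap x y xs with does (P? x) | does (P? y)
  ... | true | true = refl
  ... | true | false = refl
  ... | false | true = refl
  ... | false | false = refl

  count-tabulate-last : ∀ {m} (f : Fin (suc m) → A) →
                        V.count P? (tabulate f) ≡ V.count P? (f (F.fromℕ m) V.∷ tabulate (f ∘ F.inject₁))
  count-tabulate-last {zero} f = refl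
  count-tabulate-last {suc m} f =
    trans (cong (if does (P? (f F.zero)) then suc else id) (count-tabulate-last (f ∘ F.suc)))
          (count-swap (f F.zero) (f (F.fromℕ (suc m))) (tabulate (f ∘ F.suc ∘ F.inject₁)))

  count-tabulate-opposite : ∀ {m} (f : Fin m → A) →
                            V.count P? (tabulate (f ∘ opposite)) ≡ V.count P? (tabulate f)
  count-tabulate-opposite {zero} f = refl
  count-tabulate-opposite {suc m} f =
    trans (cong (if does (P? (f (F.fromℕ m))) then suc else id) (count-tabulate-opposite (f ∘ F.inject₁)))
          (sym (count-tabulate-last f))

∣rvSet∣ : (T : Subset n) → ∣ rvSet T ∣ ≡ ∣ T ∣
∣rvSet∣ T = trans (count-tabulate-opposite (Data.Bool._≟ inside) (lookup T))
                  (cong (V.count (Data.Bool._≟ inside)) (VP.tabulate∘lookup T))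

PrefixIs-rv : {w : Word n} (T : Subset n) → PrefixIs T w → PrefixIs (rvSet T) (rv w)
PrefixIs-rv {w = w} T prefix i rewrite ∣rvSet∣ T | lookup-rv w i = ⇔.trans (prefix i) (⇔.sym (∈-rvSet T))

FiberPrefix-rv : {x w : Word n} (T : Subset n) → FiberPrefix x T w → FiberPrefix (rv x) (rvSet T) (rv w)
FiberPrefix-rv {x = x} {w} T (perm , x~w , prefix) =
  rv-isPerm {v = w} perm , SameRect-rv x~w , PrefixIs-rv {w = w} T prefix

FiberPrefix-rv⁻ : {x w : Word n} (T : Subset n) → FiberPrefix (rv x) (rvSet T) w → FiberPrefix x T (rv w)
FiberPrefix-rv⁻ {x = x} {w} T fiber =
  subst₂ (λ x' T' → FiberPrefix x' T' (rv w)) (rv-involutive x) (rvSet-involutive T)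
    (FiberPrefix-rv (rvSet T) fiber)

filter-map : {A B : Set} {P : B → Set} {Q : A → Set} (P? : Decidable P) (Q? : Decidable Q) {f : A → B} →
             (∀ {a} → P (f a) ⇔ Q a) → ∀ xs → filter P? (L.map f xs) ≡ L.map f (filter Q? xs)
filter-map P? Q? {f} P∘f⇔Q [] = refl
filter-map P? Q? {f} P∘f⇔Q (a ∷ xs) with P? (f a) | Q? a
... | yes _ | yes _ = cong (f a ∷_) (filter-map P? Q? P∘f⇔Q xs)
... | yes p | no ¬q = ⊥-elim (¬q (Equivalence.to P∘f⇔Q p))
... | no ¬p | yes q = ⊥-elim (¬p (Equivalence.from P∘f⇔Q q))
... | no _ | no _ = filter-map P? Q? P∘f⇔Q xs

restrict-rv : (T : Subset n) (z : Word n) → rvList (restrict (rvSet T) (rv z)) ≡ restrict T z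
restrict-rv T z = begin
  L.map opposite (filter (_∈? rvSet T) (V.toList (V.map opposite z)))
    ≡⟨ cong (L.map opposite ∘ filter (_∈? rvSet T)) (VP.toList-map opposite z) ⟩
  L.map opposite (filter (_∈? rvSet T) (L.map opposite (V.toList z)))
    ≡⟨ cong (L.map opposite) (filter-map (_∈? rvSet T) (_∈? T) (∈-rvSet T) (V.toList z)) ⟩
  L.map opposite (L.map opposite (filter (_∈? T) (V.toList z)))
    ≡⟨ LP.map-∘ _ ⟨
  L.map (opposite ∘ opposite) (filter (_∈? T) (V.toList z))
    ≡⟨ LP.map-cong FP.opposite-involutive _ ⟩
  L.map id (filter (_∈? T) (V.toList z))
    ≡⟨ LP.map-id _ ⟩
  filter (_∈? T) (V.toList z)
    ∎
  where open ≡-Reasoning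

IsMaxOf⇒IsMinOf-rv : {x z : Word n} (T : Subset n) →
                     IsMaxOf (FiberPrefix x T) z → IsMinOf (FiberPrefix (rv x) (rvSet T)) (rv z)
IsMaxOf⇒IsMinOf-rv {x = x} {z} T (fiber-z , maximum) = FiberPrefix-rv T fiber-z , minimum
  where
  minimum : ∀ w → FiberPrefix (rv x) (rvSet T) w → rv z ≤w w
  minimum w fiber = subst (rv z ≤w_) (rv-involutive w)
    (≤w-rv {v = rv w} {z} (proj₁ fiber-rw) (proj₁ fiber-z) (maximum (rv w) fiber-rw))
    where
    fiber-rw : FiberPrefix x T (rv w)
    fiber-rw = FiberPrefix-rv⁻ T fiber

-- x need not be 2-clumped: only its fiber enters the argument.
lemma5p7 : (n : ℕ) (x : Word n) (T : Subset n) →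
    TwoClumped x → Good x T →
    Σ (Word n) λ xmax → Σ (Word n) λ zmin →
      IsMaxOf (FiberPrefix x T) xmax ×
      IsMinOf (FiberPrefix (rv x) (rvSet T)) zmin ×
      restrict T xmax ≡ rvList (restrict (rvSet T) zmin)
lemma5p7 n x T _ good with FiberPrefix-maximum T good
... | xmax , isMax = xmax , rv xmax , isMax , IsMaxOf⇒IsMinOf-rv T isMax , sym (restrict-rv T xmax)
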